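{- Let $q$ be a prime power, let $s\ge 1$ be an integer and let $e_1,\ldots,e_s$ be distinct non-negative integers. Let $S_{e_1,\ldots,e_s}(q)$ denote the number of equivalence classes, under dynamical equivalence, of the dynamical systems $(\mathbb{F}_q, x\mapsto f(x))$ where $f$ ranges over all polynomials of the form $f(X)=\sum_{i=1}^s a_iX^{e_i}\in\mathbb{F}_q[X]$ with $a_1,\ldots,a_s\in\mathbb{F}_q^*=\mathbb{F}_q\setminus\{0\}$. Then $$S_{e_1,\ldots,e_s}(q)\le (q-1)^{s-1}\gcd(e_1-1,\ldots,e_s-1,q-1).$$
   Context: A dynamical system is a pair $(\mathbb{S},f)$ with $f:\mathbb{S}\to\mathbb{S}$ a map. Two dynamical systems $(\mathbb{S},f)$ and $(\mathbb{T},g)$ are dynamically equivalent if there is a bijection $\sigma:\mathbb{S}\to\mathbb{T}$ with $\sigma^{ -1}\circ g\circ\sigma=f$ (equivalently, their functional graphs, i.e. the directed graphs with an edge $x\to f(x)$, are isomorphic). $\mathbb{F}_q$ is the finite field with $q$ elements. -}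

module Defs where

open import Level using (0ℓ)
open import Data.Nat using (ℕ; zero; suc)
open import Data.Nat.GCD using (gcd)
open import Data.Integer using (ℤ; +_; ∣_∣) renaming (_-_ to _-ℤ_)
open import Data.Fin using (Fin)
open import Data.Product using (Σ; ∃; _,_; _×_)
open import Function.Bundles using (_↔_; Inverse)
open import Function.Definitions using (Injective)
open import Relation.Binary.PropositionalEquality using (_≡_)
open import Relation.Nullary using (¬_)
open import Algebra.Bundles using (CommutativeRing)
import Algebra.Bundles
import Algebra.Definitions.RawSemiring as RawSemiringDefs

record FiniteField (q : ℕ) : Set₁ where
  field
    commRing : CommutativeRing 0ℓ 0ℓ
  open CommutativeRing commRing public
  field
    ≈⇒≡ : ∀ {x y} → x ≈ y → x ≡ y
    0≢1 : ¬ (0# ≡ 1#)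
    inverse : ∀ x → ¬ (x ≡ 0#) → ∃ λ y → x * y ≡ 1#
    card : Carrier ↔ Fin q
  open RawSemiringDefs (Algebra.Bundles.Semiring.rawSemiring semiring) public using (_^_; sum)

DynEquiv : {S T : Set} → (S → S) → (T → T) → Set
DynEquiv {S} {T} f g =
  Σ (S ↔ T) λ σ → ∀ x → Inverse.from σ (g (Inverse.to σ x)) ≡ f x

module _ {q : ℕ} (F : FiniteField q) where
  open FiniteField F

  NZCoeffs : ℕ → Set
  NZCoeffs s = Σ (Fin s → Carrier) λ a → ∀ i → ¬ (a i ≡ 0#)

  polyMap : {s : ℕ} → (Fin s → ℕ) → (Fin s → Carrier) → Carrier → Carrier
  polyMap e a x = sum (λ i → a i * (x ^ e i))

  -- "the number of dynamical-equivalence classes of the systems (F_q , x ↦ f(x)),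
  --  f = Σ a_i X^{e_i} with all a_i ≠ 0, is at most N":
  -- there are N admissible coefficient tuples such that every admissible system
  -- is dynamically equivalent to one of the N systems they define.
  NumClassesAtMost : {s : ℕ} → (Fin s → ℕ) → ℕ → Set
  NumClassesAtMost {s} e N =
    Σ (Fin N → NZCoeffs s) λ r →
      (a : NZCoeffs s) → ∃ λ (j : Fin N) →
        DynEquiv (polyMap e (Data.Product.proj₁ a))
                 (polyMap e (Data.Product.proj₁ (r j)))

-- |e - 1| as an integer absolute value (so e = 0 gives 1)
absPred : ℕ → ℕ
absPred e = ∣ (+ e) -ℤ (+ 1) ∣

gcdExps : {s : ℕ} → (Fin s → ℕ) → ℕ → ℕ
gcdExps {zero} e m = m
gcdExps {suc s} e m = gcd (absPred (e Fin.zero)) (gcdExps (λ i → e (Fin.suc i)) m)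
  where import Data.Fin as Fin

module Submission where

-- Theorem 3.1.  For c ≠ 0, conjugating x ↦ Σᵢ rᵢ x^eᵢ by x ↦ c x gives
-- x ↦ Σᵢ rᵢ c^(eᵢ-1) x^eᵢ, so the group F_q^* acts on the tuples (a₁, …, a_{s+1})
-- of non-zero coefficients, and tuples in one orbit define dynamically
-- equivalent systems.  A factor h fixing a tuple satisfies h^(eᵢ-1) = 1 for all
-- i and h^(q-1) = 1 (Fermat), hence h^g = 1 with g = gcd(e₁-1, …, e_{s+1}-1, q-1),
-- and a monic polynomial of degree g has at most g roots.  Counting the triples
-- (orbit representative, factor, tuple) in two ways gives
-- #orbits · (q-1) ≤ (q-1)^(s+1) · g, i.e. at most (q-1)^s · g classes.

open import Defs
open import Data.Nat using (ℕ; suc)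
open import Data.Fin using (Fin)

module Counting where
  open import Data.Nat using (ℕ; zero; suc; _+_; _*_; _≤_; z≤n; s≤s; _≟_)
  open import Data.Nat.Properties
    using (+-0-commutativeMonoid; +-mono-≤; ≤-refl; ≤-trans; m≤m+n; m≤n+m; +-identityʳ; ≤-reflexive)
  open import Data.Fin using (Fin; Fin′; zero; suc; inject; _<_)
  open import Data.Fin.Properties using (any?; suc-injective)
  open import Data.Product using (Σ; ∃; _,_; proj₂)
  open import Data.Sum using (_⊎_; inj₁; inj₂)
  open import Data.Empty using (⊥-elim)
  open import Function using (_∘_)
  open import Relation.Binary.PropositionalEquality using (_≡_; _≢_; refl; sym; trans; cong; cong₂; subst)
  open import Relation.Nullary using (¬_; Dec; yes; no)
  open import Relation.Unary using (Pred; Decidable)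
  open import Level using (0ℓ)
  open import Algebra.Properties.CommutativeMonoid.Sum +-0-commutativeMonoid
    using (sum-syntax; ∑-distrib-+)

  𝟙 : ∀ {P : Set} → Dec P → ℕ
  𝟙 (yes _) = 1
  𝟙 (no _)  = 0

  count : ∀ {n} {P : Pred (Fin n) 0ℓ} → Decidable P → ℕ
  count {n} P? = ∑[ i < n ] 𝟙 (P? i)

  ∑-mono : ∀ {n} {f g : Fin n → ℕ} → (∀ i → f i ≤ g i) → ∑[ i < n ] f i ≤ ∑[ i < n ] g i
  ∑-mono {zero}  f≤g = z≤n
  ∑-mono {suc n} f≤g = +-mono-≤ (f≤g zero) (∑-mono (f≤g ∘ suc))

  ∑-const : ∀ n k → ∑[ i < n ] k ≡ n * k
  ∑-const zero    k = refl
  ∑-const (suc n) k = cong (k +_) (∑-const n k)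

  ∑-zero : ∀ {n} {f : Fin n → ℕ} → (∀ i → f i ≡ 0) → ∑[ i < n ] f i ≡ 0
  ∑-zero {zero}  f≡0 = refl
  ∑-zero {suc n} f≡0 = cong₂ _+_ (f≡0 zero) (∑-zero (f≡0 ∘ suc))

  ∑-term : ∀ {n} (f : Fin n → ℕ) i → f i ≤ ∑[ i < n ] f i
  ∑-term f zero    = m≤m+n _ _
  ∑-term f (suc i) = ≤-trans (∑-term (f ∘ suc) i) (m≤n+m _ (f zero))

  ∑-atMostOne : ∀ {n k} {f : Fin n → ℕ} → (∀ i → f i ≤ k) →
                (∀ i j → f i ≢ 0 → f j ≢ 0 → i ≡ j) → ∑[ i < n ] f i ≤ k
  ∑-atMostOne {zero}          f≤k unique = z≤n
  ∑-atMostOne {suc n} {k} {f} f≤k unique with f zero ≟ 0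
  ... | yes f₀≡0 rewrite f₀≡0 =
    ∑-atMostOne (f≤k ∘ suc) (λ i j fi≢0 fj≢0 → suc-injective (unique (suc i) (suc j) fi≢0 fj≢0))
  ... | no f₀≢0 = subst (_≤ k) (sym onlyFirst) (f≤k zero)
    where
      restZero : ∀ i → f (suc i) ≡ 0
      restZero i with f (suc i) ≟ 0
      ... | yes fi≡0 = fi≡0
      ... | no fi≢0  = ⊥-elim (zero≢suc (unique zero (suc i) f₀≢0 fi≢0))
        where zero≢suc : zero ≢ suc i
              zero≢suc ()
      onlyFirst : f zero + ∑[ i < n ] f (suc i) ≡ f zero
      onlyFirst = trans (cong (f zero +_) (∑-zero restZero)) (+-identityʳ (f zero))

  module _ {n : ℕ} {P : Pred (Fin n) 0ℓ} (P? : Decidable P) where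

    count-none : (∀ i → ¬ P i) → count P? ≡ 0
    count-none ¬P = ∑-zero indicator≡0
      where
        indicator≡0 : ∀ i → 𝟙 (P? i) ≡ 0
        indicator≡0 i with P? i
        ... | yes p = ⊥-elim (¬P i p)
        ... | no _  = refl

    count-≥1 : ∀ {i} → P i → 1 ≤ count P?
    count-≥1 {i} p = ≤-trans (indicator≡1 (P? i)) (∑-term (λ j → 𝟙 (P? j)) i)
      where
        indicator≡1 : (d : Dec (P i)) → 1 ≤ 𝟙 d
        indicator≡1 (yes _) = ≤-refl
        indicator≡1 (no ¬p) = ⊥-elim (¬p p)

    𝟙≤count : ∀ {A : Set} (A? : Dec A) → (A → ∃ P) → 𝟙 A? ≤ count P?
    𝟙≤count (yes a) A⇒∃P = count-≥1 (proj₂ (A⇒∃P a))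
    𝟙≤count (no _)  A⇒∃P = z≤n

    count-byWitness : ∀ {k} → (∀ i → P i → count P? ≤ k) → count P? ≤ k
    count-byWitness bound with any? P?
    ... | yes (i , p) = bound i p
    ... | no ¬∃       = subst (_≤ _) (sym (count-none (λ i p → ¬∃ (i , p)))) z≤n

    count-witness : count P? ≢ 0 → ∃ P
    count-witness count≢0 with any? P?
    ... | yes ∃P = ∃P
    ... | no ¬∃  = ⊥-elim (count≢0 (count-none (λ i p → ¬∃ (i , p))))

    count-unique : (∀ i j → P i → P j → i ≡ j) → count P? ≤ 1
    count-unique unique = ∑-atMostOne indicator≤1 (λ i j i∈P j∈P → unique i j (counted i i∈P) (counted j j∈P))
      where
        indicator≤1 : ∀ i → 𝟙 (P? i) ≤ 1
        indicator≤1 i with P? i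
        ... | yes _ = ≤-refl
        ... | no _  = z≤n
        counted : ∀ i → 𝟙 (P? i) ≢ 0 → P i
        counted i 𝟙≢0 with P? i
        ... | yes p = p
        ... | no _  = ⊥-elim (𝟙≢0 refl)

  module _ {n : ℕ} {P Q R : Pred (Fin n) 0ℓ} (P? : Decidable P) (Q? : Decidable Q) (R? : Decidable R) where

    count-⊎ : (∀ i → P i → Q i ⊎ R i) → count P? ≤ count Q? + count R?
    count-⊎ P⇒Q⊎R =
      ≤-trans (∑-mono indicator≤) (≤-reflexive (∑-distrib-+ {n} (λ i → 𝟙 (Q? i)) (λ i → 𝟙 (R? i))))
      where
        indicator≤ : ∀ i → 𝟙 (P? i) ≤ 𝟙 (Q? i) + 𝟙 (R? i)
        indicator≤ i with P? i | Q? i | R? i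
        ... | no _  | _     | _     = z≤n
        ... | yes _ | yes _ | _     = s≤s z≤n
        ... | yes _ | no _  | yes _ = s≤s z≤n
        ... | yes p | no ¬q | no ¬r with P⇒Q⊎R i p
        ...   | inj₁ q = ⊥-elim (¬q q)
        ...   | inj₂ r = ⊥-elim (¬r r)

  module _ {n : ℕ} {P Q : Pred (Fin n) 0ℓ} (P? : Decidable P) (Q? : Decidable Q) where

    count-mono : (∀ i → P i → Q i) → count P? ≤ count Q?
    count-mono P⇒Q = ∑-mono indicator≤
      where
        indicator≤ : ∀ i → 𝟙 (P? i) ≤ 𝟙 (Q? i)
        indicator≤ i with P? i | Q? i
        ... | no _  | _     = z≤n
        ... | yes _ | yes _ = ≤-refl
        ... | yes p | no ¬q = ⊥-elim (¬q (P⇒Q i p))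

  -- A decidable subset of a non-empty Fin m with at most N elements is covered
  -- by a map from Fin N.
  enumerate : ∀ {m N} {P : Pred (Fin m) 0ℓ} (P? : Decidable P) → Fin m → count P? ≤ N →
              Σ (Fin N → Fin m) λ f → ∀ t → P t → ∃ λ j → f j ≡ t
  enumerate {suc m} P? _ = byFirst P?
    where
      byFirst : ∀ {m N} {P : Pred (Fin (suc m)) 0ℓ} (P? : Decidable P) → count P? ≤ N →
                Σ (Fin N → Fin (suc m)) λ f → ∀ t → P t → ∃ λ j → f j ≡ t
      byFirst {zero} {zero} P? bound = (λ ()) , λ { zero p → ⊥-elim (1≰0 (≤-trans (count-≥1 P? p) bound)) }
        where 1≰0 : ¬ (1 ≤ 0)
              1≰0 ()
      byFirst {zero} {suc N} P? bound = (λ _ → zero) , λ { zero _ → zero , refl }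
      byFirst {suc m} {N} {P} P? bound = split (P? zero) bound
        where
          split : (d : Dec (P zero)) → 𝟙 d + count (P? ∘ suc) ≤ N →
                  Σ (Fin N → Fin (suc (suc m))) λ f → ∀ t → P t → ∃ λ j → f j ≡ t
          split (no ¬p₀) bound′ with byFirst (P? ∘ suc) bound′
          ... | f , cover = suc ∘ f , λ { zero p₀ → ⊥-elim (¬p₀ p₀)
                                        ; (suc t) p → let j , fj≡t = cover t p in j , cong suc fj≡t }
          split (yes _) (s≤s bound′) with byFirst (P? ∘ suc) bound′
          ... | f , cover = extend , λ { zero _ → zero , refl
                                       ; (suc t) p → let j , fj≡t = cover t p in suc j , cong suc fj≡t }
            where extend : Fin _ → Fin (suc (suc m))
                  extend zero    = zero
                  extend (suc j) = suc (f j)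

  <⇒inject : ∀ {n} {i j : Fin n} → i < j → ∃ λ (k : Fin′ j) → inject k ≡ i
  <⇒inject {i = zero}  {j = suc j} _         = zero , refl
  <⇒inject {i = suc i} {j = suc j} (s≤s i<j) = let k , k≡i = <⇒inject i<j in suc k , cong suc k≡i

open Counting

module FieldFacts {q : ℕ} (F : FiniteField q) where
  open import Data.Nat using (ℕ; zero; suc)
  import Data.Nat as ℕ
  import Data.Nat.Properties as ℕ
  open import Data.Nat.GCD using (gcd; gcd-GCD; gcd[m,n]≢0; module Bézout)
  open import Data.Fin using (Fin)
  import Data.Fin as Fin
  import Data.Fin.Properties as FinP
  open import Data.Product using (proj₁; proj₂)
  open import Data.Sum using (inj₂)
  open import Function using (_∘_)
  open import Function.Properties.Inverse using (↔⇒↣)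
  open import Relation.Binary.PropositionalEquality
  open import Relation.Nullary using (Dec)
  open import Relation.Nullary.Decidable using (via-injection)

  gcdExps≢0 : ∀ {s} (e : Fin s → ℕ) m → m ≢ 0 → gcdExps e m ≢ 0
  gcdExps≢0 {zero}  e m m≢0 = m≢0
  gcdExps≢0 {suc s} e m m≢0 =
    gcd[m,n]≢0 (absPred (e Fin.zero)) (gcdExps (e ∘ Fin.suc) m) (inj₂ (gcdExps≢0 (e ∘ Fin.suc) m m≢0))

  open FiniteField F
    using (Carrier; _+_; _*_; -_; 0#; 1#; _^_; ≈⇒≡; 0≢1; inverse; card; commutativeSemiring)
  private module R = FiniteField F
  import Algebra.Properties.CommutativeSemiring.Exp commutativeSemiring as Exp

  infix 4 _≟_
  _≟_ : (x y : Carrier) → Dec (x ≡ y)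
  _≟_ = via-injection (↔⇒↣ card) FinP._≟_

  1≢0 : 1# ≢ 0#
  1≢0 1≡0 = 0≢1 (sym 1≡0)

  *-comm : ∀ x y → x * y ≡ y * x
  *-comm x y = ≈⇒≡ (R.*-comm x y)

  *-assoc : ∀ x y z → (x * y) * z ≡ x * (y * z)
  *-assoc x y z = ≈⇒≡ (R.*-assoc x y z)

  *-identityˡ : ∀ x → 1# * x ≡ x
  *-identityˡ x = ≈⇒≡ (R.*-identityˡ x)

  *-identityʳ : ∀ x → x * 1# ≡ x
  *-identityʳ x = ≈⇒≡ (R.*-identityʳ x)

  zeroʳ : ∀ x → x * 0# ≡ 0#
  zeroʳ x = ≈⇒≡ (R.zeroʳ x)

  inv : (x : Carrier) → x ≢ 0# → Carrier
  inv x x≢0 = proj₁ (inverse x x≢0)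

  inverseʳ : ∀ x (x≢0 : x ≢ 0#) → x * inv x x≢0 ≡ 1#
  inverseʳ x x≢0 = proj₂ (inverse x x≢0)

  inverseˡ : ∀ x (x≢0 : x ≢ 0#) → inv x x≢0 * x ≡ 1#
  inverseˡ x x≢0 = trans (*-comm _ x) (inverseʳ x x≢0)

  *-cancelˡ : ∀ {a x y} → a ≢ 0# → a * x ≡ a * y → x ≡ y
  *-cancelˡ {a} {x} {y} a≢0 ax≡ay = begin
    x                 ≡⟨ sym (*-identityˡ x) ⟩
    1# * x            ≡⟨ cong (_* x) (sym (inverseˡ a a≢0)) ⟩
    (inv a a≢0 * a) * x ≡⟨ *-assoc _ a x ⟩
    inv a a≢0 * (a * x) ≡⟨ cong (inv a a≢0 *_) ax≡ay ⟩
    inv a a≢0 * (a * y) ≡⟨ sym (*-assoc _ a y) ⟩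
    (inv a a≢0 * a) * y ≡⟨ cong (_* y) (inverseˡ a a≢0) ⟩
    1# * y            ≡⟨ *-identityˡ y ⟩
    y                 ∎
    where open ≡-Reasoning

  *-nonzero : ∀ {x y} → x ≢ 0# → y ≢ 0# → x * y ≢ 0#
  *-nonzero {x} x≢0 y≢0 xy≡0 = y≢0 (*-cancelˡ x≢0 (trans xy≡0 (sym (zeroʳ x))))

  inv-nonzero : ∀ x (x≢0 : x ≢ 0#) → inv x x≢0 ≢ 0#
  inv-nonzero x x≢0 x⁻¹≡0 = 1≢0 (trans (sym (inverseʳ x x≢0)) (trans (cong (x *_) x⁻¹≡0) (zeroʳ x)))

  ^-nonzero : ∀ {x} n → x ≢ 0# → x ^ n ≢ 0#
  ^-nonzero zero    x≢0 = 1≢0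
  ^-nonzero (suc n) x≢0 = *-nonzero x≢0 (^-nonzero n x≢0)

  ^-distrib-* : ∀ x y n → (x * y) ^ n ≡ x ^ n * y ^ n
  ^-distrib-* x y n = ≈⇒≡ (Exp.^-distrib-* x y n)

  ^-homo-* : ∀ x m n → x ^ (m ℕ.+ n) ≡ x ^ m * x ^ n
  ^-homo-* x m n = ≈⇒≡ (Exp.^-homo-* x m n)

  1^n≡1 : ∀ n → 1# ^ n ≡ 1#
  1^n≡1 zero    = refl
  1^n≡1 (suc n) = trans (*-identityˡ _) (1^n≡1 n)

  ^-multiple : ∀ h a b → h ^ b ≡ 1# → h ^ (a ℕ.* b) ≡ 1#
  ^-multiple h a b hᵇ≡1 = begin
    h ^ (a ℕ.* b) ≡⟨ cong (h ^_) (ℕ.*-comm a b) ⟩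
    h ^ (b ℕ.* a) ≡⟨ sym (≈⇒≡ (Exp.^-assocʳ h b a)) ⟩
    (h ^ b) ^ a   ≡⟨ cong (_^ a) hᵇ≡1 ⟩
    1# ^ a        ≡⟨ 1^n≡1 a ⟩
    1#            ∎
    where open ≡-Reasoning

  private
    ^-one-left : ∀ h d u v → d ℕ.+ u ≡ v → h ^ u ≡ 1# → h ^ v ≡ 1# → h ^ d ≡ 1#
    ^-one-left h d u v d+u≡v hᵘ≡1 hᵛ≡1 = begin
      h ^ d          ≡⟨ sym (*-identityʳ _) ⟩
      h ^ d * 1#     ≡⟨ cong (h ^ d *_) (sym hᵘ≡1) ⟩
      h ^ d * h ^ u  ≡⟨ sym (^-homo-* h d u) ⟩
      h ^ (d ℕ.+ u)  ≡⟨ cong (h ^_) d+u≡v ⟩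
      h ^ v          ≡⟨ hᵛ≡1 ⟩
      1#             ∎
      where open ≡-Reasoning

  -- By Bézout, h ^ a ≡ 1 and h ^ b ≡ 1 give h ^ gcd a b ≡ 1.
  ^-gcd : ∀ h a b → h ^ a ≡ 1# → h ^ b ≡ 1# → h ^ gcd a b ≡ 1#
  ^-gcd h a b hᵃ≡1 hᵇ≡1 with Bézout.identity (gcd-GCD a b)
  ... | Bézout.+- x y eq = ^-one-left h _ (y ℕ.* b) (x ℕ.* a) eq (^-multiple h y b hᵇ≡1) (^-multiple h x a hᵃ≡1)
  ... | Bézout.-+ x y eq = ^-one-left h _ (x ℕ.* a) (y ℕ.* b) eq (^-multiple h x a hᵃ≡1) (^-multiple h y b hᵇ≡1)

  ^-absPred : ∀ {h} e → h ≢ 0# → h ^ e ≡ h → h ^ absPred e ≡ 1#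
  ^-absPred zero    h≢0 h⁰≡h = trans (*-identityʳ _) (sym h⁰≡h)
  ^-absPred (suc e) h≢0 hᵉ⁺¹≡h = *-cancelˡ h≢0 (trans hᵉ⁺¹≡h (sym (*-identityʳ _)))

  ^-gcdExps : ∀ {s} (e : Fin s → ℕ) {h} m → h ≢ 0# → (∀ i → h ^ e i ≡ h) →
              h ^ m ≡ 1# → h ^ gcdExps e m ≡ 1#
  ^-gcdExps {zero}  e m h≢0 fixed hᵐ≡1 = hᵐ≡1
  ^-gcdExps {suc s} e {h} m h≢0 fixed hᵐ≡1 =
    ^-gcd h (absPred (e Fin.zero)) (gcdExps (e ∘ Fin.suc) m) (^-absPred (e Fin.zero) h≢0 (fixed Fin.zero))
                (^-gcdExps (e ∘ Fin.suc) m h≢0 (fixed ∘ Fin.suc) hᵐ≡1)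

module Roots {q : ℕ} (F : FiniteField q) where
  open import Data.Nat using (ℕ; zero; suc; _≤_)
  import Data.Nat as ℕ
  import Data.Nat.Properties as ℕ
  open import Data.Nat.Properties using (+-mono-≤; ≤-reflexive; module ≤-Reasoning)
  open import Data.Fin using (Fin)
  open import Data.List using (List; []; _∷_; length; replicate)
  open import Data.List.Properties using (length-replicate)
  open import Data.Maybe using (nothing)
  open import Data.Product using (Σ; _×_; _,_)
  open import Data.Sum using (_⊎_; inj₁; inj₂)
  open import Function.Definitions using (Injective)
  open import Relation.Binary.PropositionalEquality
  open import Relation.Nullary using (yes; no)
  import Tactic.RingSolver.Core.AlmostCommutativeRing as ACR

  open FiniteField F using (Carrier; _+_; _*_; -_; 0#; 1#; _^_; ≈⇒≡; commRing)
  private module R = FiniteField F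
  open FieldFacts F
  open import Tactic.RingSolver.NonReflective (ACR.fromCommutativeRing commRing (λ _ → nothing))
    using (solve; _⊜_; _⊕_; _⊗_)

  -- The monic polynomial c₀ + c₁ X + ⋯ + c_{d-1} X^{d-1} + X^d of degree d,
  -- represented by the list of its lower coefficients.
  evalMonic : List Carrier → Carrier → Carrier
  evalMonic []       x = 1#
  evalMonic (c ∷ cs) x = c + x * evalMonic cs x

  private
    +-vanishing : ∀ a b t → b ≡ 0# → a + b * t ≡ a
    +-vanishing a b t b≡0 = begin
      a + b * t  ≡⟨ cong (λ b → a + b * t) b≡0 ⟩
      a + 0# * t ≡⟨ ≈⇒≡ (R.trans (R.+-congˡ (R.zeroˡ t)) (R.+-identityʳ a)) ⟩
      a          ∎
      where open ≡-Reasoning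

    -r+r≡0 : ∀ r → - r + r ≡ 0#
    -r+r≡0 r = ≈⇒≡ (R.-‿inverseˡ r)

  -- Division by X - r: P(X) = (X - r) Q(X) + P(r) with Q monic of degree deg P - 1.
  -- (The ring identities are stated with m standing for - r, since m + r ≡ 0
  -- is not an identity the normaliser sees.)
  divide : ∀ c cs r → Σ (List Carrier) λ qs → length qs ≡ length cs ×
           (∀ x → evalMonic (c ∷ cs) x ≡ (x + - r) * evalMonic qs x + evalMonic (c ∷ cs) r)
  divide c [] r = [] , refl , λ x → sym (begin
      (x + - r) * 1# + (c + r * 1#)         ≡⟨ ≈⇒≡ (solve 5 (λ c x r m u →
          ((x ⊕ m) ⊗ u ⊕ (c ⊕ r ⊗ u)) ⊜ ((c ⊕ x ⊗ u) ⊕ (m ⊕ r) ⊗ u)) R.refl c x r (- r) 1#) ⟩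
      (c + x * 1#) + (- r + r) * 1#         ≡⟨ +-vanishing _ _ 1# (-r+r≡0 r) ⟩
      c + x * 1#                            ∎)
    where open ≡-Reasoning
  divide c (c′ ∷ cs) r with divide c′ cs r
  ... | qs , |qs|≡|cs| , division = R′ ∷ qs , cong suc |qs|≡|cs| , λ x → begin
      c + x * evalMonic (c′ ∷ cs) x                 ≡⟨ cong (λ t → c + x * t) (division x) ⟩
      c + x * ((x + - r) * evalMonic qs x + R′)     ≡⟨ sym (+-vanishing _ _ R′ (-r+r≡0 r)) ⟩
      c + x * ((x + - r) * evalMonic qs x + R′) + (- r + r) * R′
        ≡⟨ ≈⇒≡ (solve 6 (λ c x r m Q R′ →
             (c ⊕ x ⊗ ((x ⊕ m) ⊗ Q ⊕ R′) ⊕ (m ⊕ r) ⊗ R′) ⊜ ((x ⊕ m) ⊗ (R′ ⊕ x ⊗ Q) ⊕ (c ⊕ r ⊗ R′)))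
             R.refl c x r (- r) (evalMonic qs x) R′) ⟩
      (x + - r) * (R′ + x * evalMonic qs x) + (c + r * R′) ∎
    where
      open ≡-Reasoning
      R′ = evalMonic (c′ ∷ cs) r

  x-r≢0 : ∀ {x r} → x ≢ r → x + - r ≢ 0#
  x-r≢0 {x} {r} x≢r x-r≡0 = x≢r (begin
    x              ≡⟨ ≈⇒≡ (R.sym (R.+-identityʳ x)) ⟩
    x + 0#         ≡⟨ cong (x +_) (sym (-r+r≡0 r)) ⟩
    x + (- r + r)  ≡⟨ ≈⇒≡ (R.sym (R.+-assoc x (- r) r)) ⟩
    (x + - r) + r  ≡⟨ cong (_+ r) x-r≡0 ⟩
    0# + r         ≡⟨ ≈⇒≡ (R.+-identityˡ r) ⟩
    r              ∎)
    where open ≡-Reasoning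

  rootOfQuotient : ∀ {P Q : Carrier → Carrier} {r} → (∀ x → P x ≡ (x + - r) * Q x + P r) →
                   P r ≡ 0# → ∀ x → P x ≡ 0# → x ≡ r ⊎ Q x ≡ 0#
  rootOfQuotient {P} {Q} {r} division Pr≡0 x Px≡0 with x ≟ r
  ... | yes x≡r = inj₁ x≡r
  ... | no x≢r  = inj₂ (*-cancelˡ (x-r≢0 x≢r) (begin
    (x + - r) * Q x                ≡⟨ sym (+-vanishing _ _ 1# Pr≡0) ⟩
    (x + - r) * Q x + P r * 1#     ≡⟨ cong (_ +_) (*-identityʳ _) ⟩
    (x + - r) * Q x + P r          ≡⟨ sym (division x) ⟩
    P x                            ≡⟨ trans Px≡0 (sym (zeroʳ _)) ⟩
    (x + - r) * 0#                 ∎))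
    where open ≡-Reasoning

  rootCount : ∀ cs {m} (v : Fin m → Carrier) → Injective _≡_ _≡_ v →
              count (λ i → evalMonic cs (v i) ≟ 0#) ≤ length cs
  rootCount cs {m} v v-inj = byDegree (length cs) cs refl
    where
      open ≤-Reasoning
      byDegree : ∀ d cs → length cs ≡ d → count (λ i → evalMonic cs (v i) ≟ 0#) ≤ d
      byDegree d []       refl = ≤-reflexive (count-none {m} (λ i → 1# ≟ 0#) (λ i → 1≢0))
      byDegree (suc d) (c ∷ cs) |cs|≡d = count-byWitness (λ i → P (v i) ≟ 0#) viaQuotient
        where
          P = evalMonic (c ∷ cs)
          viaQuotient : ∀ i₀ → P (v i₀) ≡ 0# → count (λ i → P (v i) ≟ 0#) ≤ suc d
          viaQuotient i₀ root₀ with divide c cs (v i₀)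
          ... | qs , |qs|≡|cs| , division = begin
            count (λ i → P (v i) ≟ 0#)
              ≤⟨ count-⊎ (λ i → P (v i) ≟ 0#) (λ i → v i ≟ v i₀) (λ i → evalMonic qs (v i) ≟ 0#)
                          (λ i → rootOfQuotient division root₀ (v i)) ⟩
            count (λ i → v i ≟ v i₀) ℕ.+ count (λ i → evalMonic qs (v i) ≟ 0#)
              ≤⟨ +-mono-≤ (count-unique (λ i → v i ≟ v i₀) (λ i j vi≡ vj≡ → v-inj (trans vi≡ (sym vj≡))))
                          (byDegree d qs (trans |qs|≡|cs| (ℕ.suc-injective |cs|≡d))) ⟩
            suc d ∎

  evalMonic-replicate : ∀ d x → evalMonic (replicate d 0#) x ≡ x ^ d
  evalMonic-replicate zero    x = refl
  evalMonic-replicate (suc d) x = trans (≈⇒≡ (R.+-identityˡ _)) (cong (x *_) (evalMonic-replicate d x))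

  Xᵈ⁺¹-1 : ℕ → List Carrier
  Xᵈ⁺¹-1 d = - 1# ∷ replicate d 0#

  Xᵈ⁺¹-1-root : ∀ d x → x ^ suc d ≡ 1# → evalMonic (Xᵈ⁺¹-1 d) x ≡ 0#
  Xᵈ⁺¹-1-root d x xᵈ⁺¹≡1 = begin
    - 1# + x * evalMonic (replicate d 0#) x ≡⟨ cong (λ t → - 1# + x * t) (evalMonic-replicate d x) ⟩
    - 1# + x ^ suc d                        ≡⟨ cong (- 1# +_) xᵈ⁺¹≡1 ⟩
    - 1# + 1#                               ≡⟨ -r+r≡0 1# ⟩
    0#                                      ∎
    where open ≡-Reasoning

  rootsOfUnity : ∀ d {m} (v : Fin m → Carrier) → Injective _≡_ _≡_ v →
                 count (λ i → v i ^ suc d ≟ 1#) ≤ suc d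
  rootsOfUnity d {m} v v-inj = begin
    count (λ i → v i ^ suc d ≟ 1#)                 ≤⟨ count-mono _ _ (λ i → Xᵈ⁺¹-1-root d (v i)) ⟩
    count (λ i → evalMonic (Xᵈ⁺¹-1 d) (v i) ≟ 0#) ≤⟨ rootCount (Xᵈ⁺¹-1 d) v v-inj ⟩
    length (Xᵈ⁺¹-1 d)                              ≡⟨ cong suc (length-replicate d) ⟩
    suc d                                          ∎
    where open ≤-Reasoning

module NonzeroElements {q′ : ℕ} (F : FiniteField (suc q′)) where
  open import Data.Nat using (ℕ; zero; suc; NonZero)
  open import Data.Fin using (Fin; zero; suc; punchIn; punchOut)
  open import Data.Fin.Properties using (nonZeroIndex; punchIn-injective; punchInᵢ≢i; punchIn-punchOut)
  open import Data.Fin.Permutation using (Permutation; permutation; _⟨$⟩ʳ_)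
  open import Function using (Inverse; _∘_)
  open import Function.Definitions using (Injective)
  open import Relation.Binary.PropositionalEquality
  import Algebra.Properties.CommutativeMonoid.Sum as MonoidSum

  open FiniteField F using (Carrier; _*_; 0#; 1#; _^_; ≈⇒≡; card; *-commutativeMonoid)
  open FieldFacts F
  private module R = FiniteField F
  module ∏ = MonoidSum *-commutativeMonoid

  private
    to   = Inverse.to card
    from = Inverse.from card

    from-injective : ∀ {i j} → from i ≡ from j → i ≡ j
    from-injective {i} {j} eq =
      trans (sym (Inverse.strictlyInverseˡ card i)) (trans (cong to eq) (Inverse.strictlyInverseˡ card j))

  nz : Fin q′ → Carrier
  nz j = from (punchIn (to 0#) j)

  nz≢0 : ∀ j → nz j ≢ 0#
  nz≢0 j nzj≡0 = punchInᵢ≢i (to 0#) j (trans (sym (Inverse.strictlyInverseˡ card _)) (cong to nzj≡0))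

  nz-injective : Injective _≡_ _≡_ nz
  nz-injective = punchIn-injective (to 0#) _ _ ∘ from-injective

  nzIndex : ∀ x → x ≢ 0# → Fin q′
  nzIndex x x≢0 = punchOut {i = to 0#} {j = to x} (x≢0 ∘ from-injective′)
    where from-injective′ : to 0# ≡ to x → x ≡ 0#
          from-injective′ eq = trans (sym (Inverse.strictlyInverseʳ card x))
                                 (trans (cong from (sym eq)) (Inverse.strictlyInverseʳ card 0#))

  nz-nzIndex : ∀ x (x≢0 : x ≢ 0#) → nz (nzIndex x x≢0) ≡ x
  nz-nzIndex x x≢0 = trans (cong from (punchIn-punchOut _)) (Inverse.strictlyInverseʳ card x)

  q′-nonZero : NonZero q′
  q′-nonZero = nonZeroIndex (nzIndex 1# 1≢0)

  scale : ∀ a → a ≢ 0# → Fin q′ → Fin q′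
  scale a a≢0 j = nzIndex (a * nz j) (*-nonzero a≢0 (nz≢0 j))

  nz-scale : ∀ a (a≢0 : a ≢ 0#) j → nz (scale a a≢0 j) ≡ a * nz j
  nz-scale a a≢0 j = nz-nzIndex (a * nz j) (*-nonzero a≢0 (nz≢0 j))

  scale-inverse : ∀ a b (a≢0 : a ≢ 0#) (b≢0 : b ≢ 0#) → b * a ≡ 1# →
                  ∀ j → scale b b≢0 (scale a a≢0 j) ≡ j
  scale-inverse a b a≢0 b≢0 ba≡1 j = nz-injective (begin
    nz (scale b b≢0 (scale a a≢0 j)) ≡⟨ nz-scale b b≢0 _ ⟩
    b * nz (scale a a≢0 j)           ≡⟨ cong (b *_) (nz-scale a a≢0 j) ⟩
    b * (a * nz j)                   ≡⟨ sym (*-assoc b a (nz j)) ⟩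
    (b * a) * nz j                   ≡⟨ cong (_* nz j) ba≡1 ⟩
    1# * nz j                        ≡⟨ *-identityˡ (nz j) ⟩
    nz j                             ∎)
    where open ≡-Reasoning

  scaling : ∀ h → h ≢ 0# → Permutation q′ q′
  scaling h h≢0 = permutation (scale h h≢0) (scale h⁻¹ h⁻¹≢0)
    (scale-inverse h⁻¹ h h⁻¹≢0 h≢0 (inverseʳ h h≢0))
    (scale-inverse h h⁻¹ h≢0 h⁻¹≢0 (inverseˡ h h≢0))
    where
      h⁻¹ = inv h h≢0
      h⁻¹≢0 = inv-nonzero h h≢0

  ∏-nonzero : ∀ {n} (f : Fin n → Carrier) → (∀ i → f i ≢ 0#) → ∏.sum f ≢ 0#
  ∏-nonzero {zero}  f f≢0 = 1≢0
  ∏-nonzero {suc n} f f≢0 = *-nonzero (f≢0 zero) (∏-nonzero (f ∘ suc) (f≢0 ∘ suc))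

  -- Fermat's little theorem: h ^ (q - 1) ≡ 1 for every non-zero h, because
  -- scaling by h permutes the non-zero elements and so fixes their product.
  fermat : ∀ h → h ≢ 0# → h ^ q′ ≡ 1#
  fermat h h≢0 = *-cancelˡ (∏-nonzero nz nz≢0) (begin
    ∏.sum nz * h ^ q′                       ≡⟨ *-comm _ _ ⟩
    h ^ q′ * ∏.sum nz                       ≡⟨ ≈⇒≡ (R.sym (R.*-congʳ (∏.sum-replicate q′))) ⟩
    ∏.sum {q′} (λ _ → h) * ∏.sum nz         ≡⟨ ≈⇒≡ (R.sym (∏.∑-distrib-+ (λ _ → h) nz)) ⟩
    ∏.sum (λ j → h * nz j)                  ≡⟨ ∏.sum-cong-≗ (λ j → sym (nz-scale h h≢0 j)) ⟩
    ∏.sum (λ j → nz (scaling h h≢0 ⟨$⟩ʳ j)) ≡⟨ ≈⇒≡ (R.sym (∏.∑-permute nz (scaling h h≢0))) ⟩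
    ∏.sum nz                                ≡⟨ sym (*-identityʳ _) ⟩
    ∏.sum nz * 1#                           ∎)
    where open ≡-Reasoning

module Orbits {q′ : ℕ} (F : FiniteField (suc q′)) {m : ℕ} (e : Fin m → ℕ) where
  open import Data.Nat using (ℕ; zero; suc; _≤_)
  import Data.Nat as ℕ
  import Data.Nat.Properties as ℕ
  open import Data.Fin using (Fin; Fin′; zero; suc; inject; finToFun; funToFin)
  import Data.Fin.Properties as FinP
  open import Data.Product using (Σ; ∃; _×_; _,_; proj₁; proj₂)
  open import Function using (_∘_; mk↔ₛ′)
  open import Relation.Binary.PropositionalEquality
  open import Relation.Nullary using (¬_; Dec; ¬?; _×-dec_)
  open import Relation.Nullary.Decidable using (decidable-stable; map′)
  open import Relation.Binary.Definitions using (tri<; tri≈; tri>)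
  open import Data.Empty using (⊥-elim)
  import Algebra.Properties.Semiring.Sum as SemiringSum
  open import Algebra.Properties.CommutativeMonoid.Sum ℕ.+-0-commutativeMonoid using (sum-syntax; ∑-comm; sum-cong-≗)
  import Algebra.Solver.CommutativeMonoid as CommutativeMonoidSolver

  open FiniteField F using (Carrier; _*_; 0#; 1#; _^_; ≈⇒≡; semiring; *-commutativeMonoid)
  private module R = FiniteField F
  open FieldFacts F
  open Roots F using (rootsOfUnity)
  open NonzeroElements F
  module ∑F = SemiringSum semiring
  module ∑ℕ = SemiringSum ℕ.+-*-semiring
  open CommutativeMonoidSolver *-commutativeMonoid using (solve; _⊜_) renaming (_⊕_ to _·_)

  T : Set
  T = NZCoeffs F m

  coeff : T → Fin m → Carrier
  coeff = proj₁

  -- Scales c x r: conjugating x ↦ Σ rᵢ x^eᵢ by x ↦ c x gives x ↦ Σ xᵢ x^eᵢ,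
  -- i.e. rᵢ c^eᵢ ≡ xᵢ c for every i.
  record Scales (c : Carrier) (x r : T) : Set where
    constructor scales
    field componentwise : ∀ i → coeff r i * c ^ e i ≡ coeff x i * c

  Scales? : ∀ c x r → Dec (Scales c x r)
  Scales? c x r = map′ scales Scales.componentwise (FinP.all? (λ i → coeff r i * c ^ e i ≟ coeff x i * c))

  scales-one : ∀ {x r} → (∀ i → coeff r i ≡ coeff x i) → Scales 1# x r
  scales-one {x} {r} r≗x = scales λ i → cong₂ _*_ (r≗x i) (1^n≡1 (e i))

  scales-≗ : ∀ {c x y r} → (∀ i → coeff y i ≡ coeff x i) → Scales c x r → Scales c y r
  scales-≗ {c} y≗x (scales c:x→r) = scales λ i → trans (c:x→r i) (cong (_* c) (sym (y≗x i)))

  scales-trans : ∀ {c d x y z} → Scales c x y → Scales d y z → Scales (c * d) x z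
  scales-trans {c} {d} {x} {y} {z} (scales c:x→y) (scales d:y→z) = scales compose
    where
      compose : ∀ i → coeff z i * (c * d) ^ e i ≡ coeff x i * (c * d)
      compose i = begin
        zᵢ * (c * d) ^ eᵢ      ≡⟨ cong (zᵢ *_) (^-distrib-* c d eᵢ) ⟩
        zᵢ * (c ^ eᵢ * d ^ eᵢ)
          ≡⟨ ≈⇒≡ (solve 3 (λ z u v → (z · (u · v)) ⊜ ((z · v) · u)) R.refl zᵢ (c ^ eᵢ) (d ^ eᵢ)) ⟩
        (zᵢ * d ^ eᵢ) * c ^ eᵢ ≡⟨ cong (_* c ^ eᵢ) (d:y→z i) ⟩
        (yᵢ * d) * c ^ eᵢ
          ≡⟨ ≈⇒≡ (solve 3 (λ y d u → ((y · d) · u) ⊜ ((y · u) · d)) R.refl yᵢ d (c ^ eᵢ)) ⟩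
        (yᵢ * c ^ eᵢ) * d      ≡⟨ cong (_* d) (c:x→y i) ⟩
        (xᵢ * c) * d           ≡⟨ *-assoc xᵢ c d ⟩
        xᵢ * (c * d)           ∎
        where
          open ≡-Reasoning
          xᵢ = coeff x i
          yᵢ = coeff y i
          zᵢ = coeff z i
          eᵢ = e i

  scales-sym : ∀ {c x r} (c≢0 : c ≢ 0#) → Scales c x r → Scales (inv c c≢0) r x
  scales-sym {c} {x} {r} c≢0 (scales c:x→r) = scales invert
    where
      c⁻¹ = inv c c≢0
      invert : ∀ i → coeff x i * c⁻¹ ^ e i ≡ coeff r i * c⁻¹
      invert i = begin
        xᵢ * c⁻¹ ^ eᵢ                  ≡⟨ sym (*-identityʳ _) ⟩
        xᵢ * c⁻¹ ^ eᵢ * 1#             ≡⟨ cong (xᵢ * c⁻¹ ^ eᵢ *_) (sym (inverseʳ c c≢0)) ⟩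
        xᵢ * c⁻¹ ^ eᵢ * (c * c⁻¹)
          ≡⟨ ≈⇒≡ (solve 4 (λ x u c v → ((x · u) · (c · v)) ⊜ (((x · c) · u) · v)) R.refl xᵢ (c⁻¹ ^ eᵢ) c c⁻¹) ⟩
        (xᵢ * c) * c⁻¹ ^ eᵢ * c⁻¹      ≡⟨ cong (λ t → t * c⁻¹ ^ eᵢ * c⁻¹) (sym (c:x→r i)) ⟩
        (rᵢ * c ^ eᵢ) * c⁻¹ ^ eᵢ * c⁻¹
          ≡⟨ ≈⇒≡ (solve 4 (λ r u w v → (((r · u) · w) · v) ⊜ ((r · (u · w)) · v)) R.refl rᵢ (c ^ eᵢ) (c⁻¹ ^ eᵢ) c⁻¹) ⟩
        rᵢ * (c ^ eᵢ * c⁻¹ ^ eᵢ) * c⁻¹ ≡⟨ cong (λ t → rᵢ * t * c⁻¹) (sym (^-distrib-* c c⁻¹ eᵢ)) ⟩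
        rᵢ * (c * c⁻¹) ^ eᵢ * c⁻¹      ≡⟨ cong (λ t → rᵢ * t ^ eᵢ * c⁻¹) (inverseʳ c c≢0) ⟩
        rᵢ * 1# ^ eᵢ * c⁻¹             ≡⟨ cong (λ t → rᵢ * t * c⁻¹) (1^n≡1 eᵢ) ⟩
        rᵢ * 1# * c⁻¹                  ≡⟨ cong (_* c⁻¹) (*-identityʳ rᵢ) ⟩
        rᵢ * c⁻¹                       ∎
        where
          open ≡-Reasoning
          xᵢ = coeff x i
          rᵢ = coeff r i
          eᵢ = e i

  scales-from : ∀ {c} → c ≢ 0# → (r : T) → Σ T λ x → Scales c x r
  scales-from {c} c≢0 (r , r≢0) =
    ((λ i → r i * c ^ e i * c⁻¹) , (λ i → *-nonzero (*-nonzero (r≢0 i) (^-nonzero (e i) c≢0)) (inv-nonzero c c≢0))) ,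
    scales λ i → begin
      r i * c ^ e i              ≡⟨ sym (*-identityʳ _) ⟩
      r i * c ^ e i * 1#         ≡⟨ cong (r i * c ^ e i *_) (sym (inverseˡ c c≢0)) ⟩
      r i * c ^ e i * (c⁻¹ * c)  ≡⟨ sym (*-assoc _ c⁻¹ c) ⟩
      r i * c ^ e i * c⁻¹ * c    ∎
    where
      open ≡-Reasoning
      c⁻¹ = inv c c≢0

  scales-fixed : ∀ {h r} → Scales h r r → ∀ i → h ^ e i ≡ h
  scales-fixed {r = r} (scales h:r→r) i = *-cancelˡ (proj₂ r i) (h:r→r i)

  scales-dynEquiv : ∀ {c x r} → c ≢ 0# → Scales c x r →
                    DynEquiv (polyMap F e (coeff x)) (polyMap F e (coeff r))
  scales-dynEquiv {c} {x} {r} c≢0 (scales c:x→r) = σ , conjugate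
    where
      c⁻¹ = inv c c≢0
      σ = mk↔ₛ′ (c *_) (c⁻¹ *_) (cancel c c⁻¹ (inverseʳ c c≢0)) (cancel c⁻¹ c (inverseˡ c c≢0))
        where
          cancel : ∀ a b → a * b ≡ 1# → ∀ y → a * (b * y) ≡ y
          cancel a b ab≡1 y = trans (sym (*-assoc a b y)) (trans (cong (_* y) ab≡1) (*-identityˡ y))
      term : ∀ y i → c⁻¹ * (coeff r i * (c * y) ^ e i) ≡ coeff x i * y ^ e i
      term y i = begin
        c⁻¹ * (rᵢ * (c * y) ^ eᵢ)       ≡⟨ cong (λ t → c⁻¹ * (rᵢ * t)) (^-distrib-* c y eᵢ) ⟩
        c⁻¹ * (rᵢ * (c ^ eᵢ * y ^ eᵢ))
          ≡⟨ ≈⇒≡ (solve 4 (λ v r u w → (v · (r · (u · w))) ⊜ (((r · u) · v) · w)) R.refl c⁻¹ rᵢ (c ^ eᵢ) (y ^ eᵢ)) ⟩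
        (rᵢ * c ^ eᵢ) * c⁻¹ * y ^ eᵢ    ≡⟨ cong (λ t → t * c⁻¹ * y ^ eᵢ) (c:x→r i) ⟩
        (xᵢ * c) * c⁻¹ * y ^ eᵢ         ≡⟨ cong (_* y ^ eᵢ) (*-assoc xᵢ c c⁻¹) ⟩
        xᵢ * (c * c⁻¹) * y ^ eᵢ         ≡⟨ cong (λ t → xᵢ * t * y ^ eᵢ) (inverseʳ c c≢0) ⟩
        xᵢ * 1# * y ^ eᵢ                ≡⟨ cong (_* y ^ eᵢ) (*-identityʳ xᵢ) ⟩
        xᵢ * y ^ eᵢ                     ∎
        where
          open ≡-Reasoning
          xᵢ = coeff x i
          rᵢ = coeff r i
          eᵢ = e i
      conjugate : ∀ y → c⁻¹ * polyMap F e (coeff r) (c * y) ≡ polyMap F e (coeff x) y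
      conjugate y = trans (≈⇒≡ (∑F.*-distribˡ-sum {m} c⁻¹ (λ i → coeff r i * (c * y) ^ e i)))
                          (∑F.sum-cong-≗ (term y))

  infix 4 _∼_ _∼?_
  _∼_ : T → T → Set
  x ∼ r = ∃ λ j → Scales (nz j) x r

  _∼?_ : ∀ x r → Dec (x ∼ r)
  x ∼? r = FinP.any? (λ j → Scales? (nz j) x r)

  ∼-intro : ∀ {c x r} → c ≢ 0# → Scales c x r → x ∼ r
  ∼-intro {c} c≢0 c:x→r = nzIndex c c≢0 , subst (λ c → Scales c _ _) (sym (nz-nzIndex c c≢0)) c:x→r

  ∼-sym : ∀ {x r} → x ∼ r → r ∼ x
  ∼-sym (j , s) = ∼-intro (inv-nonzero (nz j) (nz≢0 j)) (scales-sym (nz≢0 j) s)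

  ∼-trans : ∀ {x y z} → x ∼ y → y ∼ z → x ∼ z
  ∼-trans (j , s) (k , t) = ∼-intro (*-nonzero (nz≢0 j) (nz≢0 k)) (scales-trans s t)

  -- The (q - 1)ᵐ tuples, enumerated by Fin M through base-(q - 1) digits.
  M : ℕ
  M = q′ ℕ.^ m

  tuple : Fin M → T
  tuple t = (λ i → nz (finToFun t i)) , (λ i → nz≢0 (finToFun t i))

  tuple-complete : (a : T) → Σ (Fin M) λ t → ∀ i → coeff (tuple t) i ≡ coeff a i
  tuple-complete (a , a≢0) =
    funToFin digits , λ i → trans (cong nz (FinP.finToFun-funToFin digits i)) (nz-nzIndex (a i) (a≢0 i))
    where digits = λ i → nzIndex (a i) (a≢0 i)

  IsRep : Fin M → Set
  IsRep t = (k : Fin′ t) → ¬ (tuple (inject k) ∼ tuple t)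

  IsRep? : ∀ t → Dec (IsRep t)
  IsRep? t = FinP.all? (λ k → ¬? (tuple (inject k) ∼? tuple t))

  rep-exists : ∀ x → Σ (Fin M) λ t → IsRep t × x ∼ tuple t
  rep-exists x with FinP.¬∀⟶∃¬-smallest M (λ t → ¬ (x ∼ tuple t)) (λ t → ¬? (x ∼? tuple t)) inOrbit
    where inOrbit : ¬ (∀ t → ¬ (x ∼ tuple t))
          inOrbit notInOrbit = let t , t≗x = tuple-complete x in notInOrbit t (∼-intro 1≢0 (scales-one t≗x))
  ... | t , ¬¬x∼t , earlier = t , isRep , x∼t
    where
      x∼t = decidable-stable (x ∼? tuple t) ¬¬x∼t
      isRep : IsRep t
      isRep k k∼t = earlier k (∼-trans x∼t (∼-sym k∼t))

  rep-unique : ∀ {x t u} → IsRep t → IsRep u → x ∼ tuple t → x ∼ tuple u → t ≡ u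
  rep-unique {x} {t} {u} rep-t rep-u x∼t x∼u with FinP.<-cmp t u
  ... | tri≈ _ t≡u _ = t≡u
  ... | tri< t<u _ _ = let k , k≡t = <⇒inject t<u in
                       ⊥-elim (rep-u k (subst (λ s → tuple s ∼ tuple u) (sym k≡t) (∼-trans (∼-sym x∼t) x∼u)))
  ... | tri> _ _ u<t = let k , k≡u = <⇒inject u<t in
                       ⊥-elim (rep-t k (subst (λ s → tuple s ∼ tuple t) (sym k≡u) (∼-trans (∼-sym x∼u) x∼t)))

  g : ℕ
  g = gcdExps e q′

  g-positive : ∃ λ d → g ≡ suc d
  g-positive with g | gcdExps≢0 e q′ (ℕ.≢-nonZero⁻¹ q′ {{q′-nonZero}})
  ... | zero  | g≢0 = ⊥-elim (g≢0 refl)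
  ... | suc d | _   = d , refl

  -- At most g non-zero factors scale a given x to a given r: if c₀ is one of
  -- them, every other c gives c₀⁻¹ c in the stabiliser of r, a root of X^g - 1.
  stabiliser-bound : ∀ x r → count (λ j → Scales? (nz j) x r) ≤ g
  stabiliser-bound x r = count-byWitness (λ j → Scales? (nz j) x r) viaFirst
    where
      open ℕ.≤-Reasoning
      viaFirst : ∀ j₀ → Scales (nz j₀) x r → count (λ j → Scales? (nz j) x r) ≤ g
      viaFirst j₀ c₀:x→r = begin
        count (λ j → Scales? (nz j) x r) ≤⟨ count-mono _ _ (λ j c:x→r → ratioᵍ≡1 j c:x→r) ⟩
        count (λ j → ratio j ^ g ≟ 1#)   ≤⟨ rootsOfUnityᵍ ⟩
        g                                ∎
        where
          c₀⁻¹ = inv (nz j₀) (nz≢0 j₀)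
          c₀⁻¹≢0 = inv-nonzero (nz j₀) (nz≢0 j₀)
          ratio : Fin q′ → Carrier
          ratio j = c₀⁻¹ * nz j
          ratio-injective : ∀ {j k} → ratio j ≡ ratio k → j ≡ k
          ratio-injective = nz-injective ∘ *-cancelˡ c₀⁻¹≢0
          ratioᵍ≡1 : ∀ j → Scales (nz j) x r → ratio j ^ g ≡ 1#
          ratioᵍ≡1 j c:x→r = ^-gcdExps e q′ ratio≢0 (scales-fixed stabilises) (fermat _ ratio≢0)
            where
              ratio≢0 = *-nonzero c₀⁻¹≢0 (nz≢0 j)
              stabilises : Scales (ratio j) r r
              stabilises = scales-trans (scales-sym (nz≢0 j₀) c₀:x→r) c:x→r
          rootsOfUnityᵍ : count (λ j → ratio j ^ g ≟ 1#) ≤ g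
          rootsOfUnityᵍ with g | g-positive
          ... | .(suc d) | d , refl = rootsOfUnity d ratio ratio-injective

  hits : Fin M → Fin q′ → Fin M → ℕ
  hits t j x = 𝟙 (IsRep? t ×-dec Scales? (nz j) (tuple x) (tuple t))

  -- Each representative is hit by every scaling factor.
  hits-lower : ∀ t → 𝟙 (IsRep? t) ℕ.* q′ ≤ ∑[ j < q′ ] ∑[ x < M ] hits t j x
  hits-lower t = begin
    𝟙 (IsRep? t) ℕ.* q′                ≡⟨ ℕ.*-comm (𝟙 (IsRep? t)) q′ ⟩
    q′ ℕ.* 𝟙 (IsRep? t)                ≡⟨ sym (∑-const q′ (𝟙 (IsRep? t))) ⟩
    ∑[ j < q′ ] 𝟙 (IsRep? t)           ≤⟨ ∑-mono (λ j → 𝟙≤count _ (IsRep? t) (λ rep → preimage j rep)) ⟩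
    ∑[ j < q′ ] ∑[ x < M ] hits t j x ∎
    where
      open ℕ.≤-Reasoning
      preimage : ∀ j → IsRep t → ∃ λ x → IsRep t × Scales (nz j) (tuple x) (tuple t)
      preimage j rep =
        let x , j:x→t = scales-from (nz≢0 j) (tuple t)
            k , k≗x = tuple-complete x
        in k , rep , scales-≗ k≗x j:x→t

  -- Each tuple hits only the representative of its orbit, by at most g factors.
  hits-upper : ∀ x → ∑[ t < M ] ∑[ j < q′ ] hits t j x ≤ g
  hits-upper x = ∑-atMostOne bounded onlyRep
    where
      Hit? : ∀ t j → Dec (IsRep t × Scales (nz j) (tuple x) (tuple t))
      Hit? t j = IsRep? t ×-dec Scales? (nz j) (tuple x) (tuple t)
      bounded : ∀ t → count (Hit? t) ≤ g
      bounded t = ℕ.≤-trans (count-mono (Hit? t) _ (λ j → proj₂)) (stabiliser-bound (tuple x) (tuple t))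
      orbitRep : ∀ t → count (Hit? t) ≢ 0 → IsRep t × tuple x ∼ tuple t
      orbitRep t hit with count-witness (Hit? t) hit
      ... | j , rep , j:x→t = rep , (j , j:x→t)
      onlyRep : ∀ t u → count (Hit? t) ≢ 0 → count (Hit? u) ≢ 0 → t ≡ u
      onlyRep t u hit-t hit-u =
        let rep-t , x∼t = orbitRep t hit-t
            rep-u , x∼u = orbitRep u hit-u
        in rep-unique rep-t rep-u x∼t x∼u

  orbitCount : count IsRep? ℕ.* q′ ≤ M ℕ.* g
  orbitCount = begin
    count IsRep? ℕ.* q′                              ≡⟨ ∑ℕ.*-distribʳ-sum q′ (λ t → 𝟙 (IsRep? t)) ⟩
    ∑[ t < M ] (𝟙 (IsRep? t) ℕ.* q′)                 ≤⟨ ∑-mono hits-lower ⟩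
    ∑[ t < M ] ∑[ j < q′ ] ∑[ x < M ] hits t j x     ≡⟨ sum-cong-≗ (λ t → ∑-comm (hits t)) ⟩
    ∑[ t < M ] ∑[ x < M ] ∑[ j < q′ ] hits t j x     ≡⟨ ∑-comm (λ t x → ∑[ j < q′ ] hits t j x) ⟩
    ∑[ x < M ] ∑[ t < M ] ∑[ j < q′ ] hits t j x     ≤⟨ ∑-mono hits-upper ⟩
    ∑[ x < M ] g                                     ≡⟨ ∑-const M g ⟩
    M ℕ.* g                                          ∎
    where open ℕ.≤-Reasoning

  classesAtMostOrbits : ∀ {N} → count IsRep? ≤ N → NumClassesAtMost F e N
  classesAtMostOrbits bound = tuple ∘ index , classify
    where
      ones : T
      ones = (λ _ → 1#) , (λ _ → 1≢0)
      enumeration = enumerate IsRep? (proj₁ (tuple-complete ones)) bound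
      index = proj₁ enumeration
      classify : ∀ a → ∃ λ j → DynEquiv (polyMap F e (coeff a)) (polyMap F e (coeff (tuple (index j))))
      classify a =
        let t , rep , (k , k:a→t) = rep-exists a
            j , index-j≡t = proj₂ enumeration t rep
        in j , subst (λ u → DynEquiv (polyMap F e (coeff a)) (polyMap F e (coeff (tuple u))))
                     (sym index-j≡t) (scales-dynEquiv (nz≢0 k) k:a→t)

open import Data.Nat using (ℕ; zero; suc; _∸_; _*_; _^_; _≤_)
import Data.Nat.Properties as ℕ
open import Data.Fin using (Fin)
open import Data.Fin.Properties using (¬Fin0)
open import Data.Empty using (⊥-elim)
open import Function using (Inverse)
open import Function.Definitions using (Injective)
open import Relation.Binary.PropositionalEquality

theorem3p1 : (q : ℕ) → (F : FiniteField q) → (s : ℕ) → (e : Fin (suc s) → ℕ) →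
    Injective _≡_ _≡_ e →
    NumClassesAtMost F e (((q ∸ 1) ^ s) * gcdExps e (q ∸ 1))
-- A field has at least one element, so q ≥ 1; the number of classes is at most
-- the number of orbits, which the double count bounds after dividing by q - 1.
theorem3p1 zero     F s e _ = ⊥-elim (¬Fin0 (Inverse.to (FiniteField.card F) (FiniteField.0# F)))
theorem3p1 (suc q′) F s e _ = classesAtMostOrbits orbitBound
  where
    open Orbits F e
    open NonzeroElements F using (q′-nonZero)
    reorder : ∀ a b c → a * b * c ≡ b * c * a
    reorder a b c = trans (ℕ.*-assoc a b c) (ℕ.*-comm a (b * c))
    orbitBound : count IsRep? ≤ q′ ^ s * g
    orbitBound = ℕ.*-cancelʳ-≤ _ _ q′ {{q′-nonZero}}
                   (subst (count IsRep? * q′ ≤_) (reorder q′ (q′ ^ s) g) orbitCount)
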